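{- Let $(\rho_b,\rho_g,\iota)$ be an effect-oriented rule with maximal rule $\rho_g=(L_g\supseteq K_g\subseteq R_g,\mathit{ac}_g)$ and base rule $\rho_b=(L_b\supseteq K_b\subseteq R_b,\mathit{ac}_b)$. Then the number $n$ of its induced rules (up to isomorphism) satisfies $$2^{|V_{L_g}\setminus V_{L_b}|+|V_{R_g}\setminus V_{R_b}|}\le n\le 2^{|V_{L_g}\setminus V_{L_b}|+|E_{L_g}\setminus E_{L_b}|+|V_{R_g}\setminus V_{R_b}|+|E_{R_g}\setminus E_{R_b}|},$$ where $V_X$ and $E_X$ denote the node and edge sets of a graph $X$.
   Context: All graphs are finite directed multigraphs typed over a fixed type graph, and all morphisms are type-preserving graph morphisms. A rule $\rho=(L\supseteq K\subseteq R,\mathit{ac})$ consists of graphs $L,K,R$ with $K$ a subgraph of both $L$ and $R$ and a nested graph condition $\mathit{ac}$ over $L$. For an injective morphism $f$ with domain $L$, $\mathrm{Shift}(f,\mathit{ac})$ denotes the standard shift of $\mathit{ac}$ along $f$. A rule $\rho'=(L'\supseteq K'\subseteq R',\mathit{ac}')$ is a subrule of $\rho$ via injective morphisms $\iota_X\colon X'\hookrightarrow X$ ($X\in\{L,K,R\}$) commuting with the rule inclusions such that both resulting squares are pullbacks and $\mathit{ac}\equiv\mathrm{Shift}(\iota_L,\mathit{ac}')$. An effect-oriented rule $(\rho_b,\rho_g,\iota)$ consists of a rule $\rho_g=(L_g\supseteq K_g\subseteq R_g,\mathit{ac}_g)$ (maximal rule) and a subrule $\rho_b=(L_b\supseteq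 K_b\subseteq R_b,\mathit{ac}_b)$ (base rule) with subrule embedding $\iota=(\iota_L,\iota_K,\iota_R)$ consisting of inclusions, such that $K_b=K_g$ and $\iota_K$ is the identity. Induced rules: choose a graph $L_i'$ with $L_b\subseteq L_i'\subseteq L_g$ and a graph $K_i$ with $K_g\subseteq K_i\subseteq R_g$ such that $K_i\cap R_b=K_b$ (equivalently, the square formed by $K_b\subseteq R_b\subseteq R_g$ and $K_b\subseteq K_i\subseteq R_g$ is a pullback). Let $L_i$ be the pushout of the inclusions $K_b\hookrightarrow L_i'$ and $K_b\hookrightarrow K_i$, chosen so that $L_i'\subseteq L_i$ and $K_i\subseteq L_i$ are inclusions, and let $\mathit{ac}_i=\mathrm{Shift}(L_b\hookrightarrow L_i,\mathit{ac}_b)$. The rule $(L_i\supseteq K_i\subseteq R_g,\mathit{ac}_i)$ is an induced rule of $(\rho_b,\rho_g,\iota)$. -}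

module Defs where

open import Data.Nat using (ℕ; _+_; _^_; _≤_)
open import Data.Fin using (Fin)
open import Data.Fin.Subset using (Subset; _∈_; _⊆_; _∩_; _─_; ∣_∣)
open import Data.Fin.Subset.Properties using (_∈?_; _⊆?_)
open import Data.Fin.Properties using (all?)
open import Data.Bool.Properties using () renaming (_≟_ to _≟B_)
open import Data.Vec.Properties using (≡-dec)
open import Data.Product using (Σ; _×_; _,_; proj₁; proj₂)
open import Relation.Nullary using (Dec)
open import Relation.Nullary.Decidable using (True; _×-dec_; _→-dec_)
open import Relation.Binary.PropositionalEquality using (_≡_)

record Graph : Set where
  field
    nV  : ℕ
    nE  : ℕ
    src : Fin nE → Fin nV
    tgt : Fin nE → Fin nV
open Graph public

record Typed (TG : Graph) : Set where
  field
    G      : Graph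
    typeV  : Fin (nV G) → Fin (nV TG)
    typeE  : Fin (nE G) → Fin (nE TG)
    src-ty : ∀ e → typeV (src G e) ≡ src TG (typeE e)
    tgt-ty : ∀ e → typeV (tgt G e) ≡ tgt TG (typeE e)
open Typed public

-- Subgraphs of a graph G, given by a node set and an edge set
-- (subgraphs of a typed graph are typed by restriction, so all
-- inclusions are type-preserving).

record SubG (G : Graph) : Set where
  constructor sub
  field
    Vs : Subset (nV G)
    Es : Subset (nE G)
open SubG public

module _ {G : Graph} where

  IsSubgraph : SubG G → Set
  IsSubgraph X = ∀ e → e ∈ Es X → (src G e ∈ Vs X) × (tgt G e ∈ Vs X)

  isSubgraph? : (X : SubG G) → Dec (IsSubgraph X)
  isSubgraph? X = all? (λ e → (e ∈? Es X) →-dec ((src G e ∈? Vs X) ×-dec (tgt G e ∈? Vs X)))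

  _⊑_ : SubG G → SubG G → Set
  X ⊑ Y = (Vs X ⊆ Vs Y) × (Es X ⊆ Es Y)

  _⊑?_ : (X Y : SubG G) → Dec (X ⊑ Y)
  X ⊑? Y = (Vs X ⊆? Vs Y) ×-dec (Es X ⊆? Es Y)

  _⊓_ : SubG G → SubG G → SubG G
  X ⊓ Y = sub (Vs X ∩ Vs Y) (Es X ∩ Es Y)

  _≟G_ : (X Y : SubG G) → Dec ((Vs X ≡ Vs Y) × (Es X ≡ Es Y))
  X ≟G Y = ≡-dec _≟B_ (Vs X) (Vs Y) ×-dec ≡-dec _≟B_ (Es X) (Es Y)

  _≐_ : SubG G → SubG G → Set
  X ≐ Y = (Vs X ≡ Vs Y) × (Es X ≡ Es Y)

-- A rule L ⊇ K ⊆ R with inclusions is represented inside the graph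
-- H = L ∪_K R (the pushout of the rule span) by subgraphs L, R with
-- K = L ∩ R.  The base rule L_b ⊇ K_b ⊆ R_b has K_b = K_g and
-- L_b ⊆ L_g, R_b ⊆ R_g; the pullback conditions of the subrule
-- embedding then amount to K_g ⊆ L_b and K_g ⊆ R_b.
-- (Application conditions are omitted.)

record EffectOrientedRule {TG : Graph} (H : Typed TG) : Set where
  field
    Lg Kg Rg Lb Rb : SubG (G H)
    Lg-sub : IsSubgraph Lg
    Kg-sub : IsSubgraph Kg
    Rg-sub : IsSubgraph Rg
    Lb-sub : IsSubgraph Lb
    Rb-sub : IsSubgraph Rb
    Kg≐Lg⊓Rg : Kg ≐ (Lg ⊓ Rg)
    Lb⊑Lg : Lb ⊑ Lg
    Rb⊑Rg : Rb ⊑ Rg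
    Kg⊑Lb : Kg ⊑ Lb
    Kg⊑Rb : Kg ⊑ Rb
open EffectOrientedRule public

-- Induced rules: a choice of L_i' with L_b ⊆ L_i' ⊆ L_g and K_i with
-- K_g ⊆ K_i ⊆ R_g and K_i ∩ R_b = K_b (= K_g).  The induced rule
-- (L_i ⊇ K_i ⊆ R_g, ac_i) is determined (up to the isomorphism in the
-- choice of pushout L_i) by the pair (L_i', K_i).

module _ {TG : Graph} {H : Typed TG} (ρ : EffectOrientedRule H) where

  IsInducedChoice : SubG (G H) → SubG (G H) → Set
  IsInducedChoice L' K' =
    (IsSubgraph L' × (Lb ρ ⊑ L') × (L' ⊑ Lg ρ)) ×
    (IsSubgraph K' × (Kg ρ ⊑ K') × (K' ⊑ Rg ρ) × ((K' ⊓ Rb ρ) ≐ Kg ρ))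

  isInducedChoice? : (L' K' : SubG (G H)) → Dec (IsInducedChoice L' K')
  isInducedChoice? L' K' =
    (isSubgraph? L' ×-dec (Lb ρ ⊑? L') ×-dec (L' ⊑? Lg ρ)) ×-dec
    (isSubgraph? K' ×-dec (Kg ρ ⊑? K') ×-dec (K' ⊑? Rg ρ) ×-dec ((K' ⊓ Rb ρ) ≟G Kg ρ))

  -- The type of induced rules (up to isomorphism); the proof component
  -- is proof-irrelevant (True of a decision), so elements correspond
  -- exactly to valid pairs (L_i', K_i).
  InducedRule : Set
  InducedRule = Σ (SubG (G H) × SubG (G H))
                  (λ p → True (isInducedChoice? (proj₁ p) (proj₂ p)))

  lowerExp : ℕ
  lowerExp = ∣ Vs (Lg ρ) ─ Vs (Lb ρ) ∣ + ∣ Vs (Rg ρ) ─ Vs (Rb ρ) ∣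

  upperExp : ℕ
  upperExp = ∣ Vs (Lg ρ) ─ Vs (Lb ρ) ∣ + ∣ Es (Lg ρ) ─ Es (Lb ρ) ∣
           + ∣ Vs (Rg ρ) ─ Vs (Rb ρ) ∣ + ∣ Es (Rg ρ) ─ Es (Rb ρ) ∣

-- An induced rule is given by a pair (L_i', K_i) of subgraphs of the finite
-- graph L_g ∪ R_g, so induced rules form a decidable subset of a finite set and
-- can be counted.  Since L_b ⊆ L_i' ⊆ L_g, the graph L_i' is determined by the
-- nodes and edges it has in L_g ∖ L_b; since K_i ⊆ R_g and K_i ∩ R_b = K_b, the
-- graph K_i is determined by the nodes and edges it has in R_g ∖ R_b: this
-- gives the upper bound.  Conversely, adding to L_b any nodes of L_g ∖ L_b and
-- to K_b any nodes of R_g ∖ R_b yields an induced rule (no edges are added, and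
-- the new nodes of K_i avoid R_b), and different choices give different rules:
-- this gives the lower bound.
module Submission where

open import Defs
open import Data.Nat using (ℕ; _^_; _≤_; _+_; zero; suc)
open import Data.Nat.Properties using (^-distribˡ-+-*)
open import Data.Fin using (Fin; zero; suc)
open import Data.Fin.Properties using (0↔⊥; 1↔⊤; 2↔Bool; +↔⊎; *↔×; injective⇒≤)
open import Data.Fin.Subset using (Subset; _⊆_; _∩_; _∪_; _─_; ∣_∣)
open import Data.Fin.Subset.Properties
  using (⊆-refl; ⊆-trans; ⊆-antisym; drop-∷-⊆; out⊆; in⊆in; p⊆p∪q; x∈p∪q⁻; p∩q⊆p; x∈p∩q⁺; p─q⊆p; ∩-comm)
open import Data.Bool using (Bool; true; false; T; if_then_else_; _∨_)
open import Data.Bool.Properties using (T-irrelevant; ∧-identityʳ; ∧-zeroʳ; ∨-identityʳ)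
open import Data.Vec using (Vec; []; _∷_; here)
open import Data.Vec.Properties using (∷-injectiveˡ; ∷-injectiveʳ)
open import Data.Product using (Σ; _×_; _,_; proj₁; proj₂)
open import Data.Product.Algebra using (×-cong; ×-assoc)
open import Data.Product.Function.Dependent.Propositional using (Σ-↔)
open import Data.Sum using (_⊎_; inj₁; inj₂; [_,_])
open import Data.Sum.Algebra using (⊎-cong)
open import Function using (_∘_)
open import Function.Bundles using (_↔_; _↣_; Inverse; Injection; mk↔ₛ′; mk↣)
open import Function.Properties.Inverse using (↔-refl; ↔-sym; ↔-trans; ↔⇒↣)
open import Function.Properties.Injection using (↣-trans)
open import Relation.Nullary using (contradiction)
open import Relation.Nullary.Decidable using (isYes; toWitness; fromWitness)
open import Relation.Binary.PropositionalEquality using (_≡_; refl; sym; trans; cong; cong₂; subst)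

Vec-suc↔× : ∀ {A : Set} {n} → Vec A (suc n) ↔ (A × Vec A n)
Vec-suc↔× = mk↔ₛ′ (λ { (x ∷ xs) → x , xs }) (λ (x , xs) → x ∷ xs) (λ _ → refl) (λ { (_ ∷ _) → refl })

Subset↔Fin : ∀ {n} → Subset n ↔ Fin (2 ^ n)
Subset↔Fin {zero} = mk↔ₛ′ (λ _ → zero) (λ _ → []) (λ { zero → refl }) (λ { [] → refl })
Subset↔Fin {suc n} =
  ↔-trans Vec-suc↔× (↔-trans (×-cong (↔-sym 2↔Bool) Subset↔Fin) (↔-sym *↔×))

×↔Fin-2^+ : ∀ {A B : Set} m n → A ↔ Fin (2 ^ m) → B ↔ Fin (2 ^ n) → (A × B) ↔ Fin (2 ^ (m + n))
×↔Fin-2^+ m n A↔ B↔ =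
  subst (λ k → _ ↔ Fin k) (sym (^-distribˡ-+-* 2 m n)) (↔-trans (×-cong A↔ B↔) (↔-sym *↔×))

Σ-Fin-suc↔⊎ : ∀ {m} {P : Fin (suc m) → Set} → Σ (Fin (suc m)) P ↔ (P zero ⊎ Σ (Fin m) (P ∘ suc))
Σ-Fin-suc↔⊎ = mk↔ₛ′
  (λ { (zero , p) → inj₁ p ; (suc i , p) → inj₂ (i , p) })
  [ (zero ,_) , (λ (i , p) → suc i , p) ]
  (λ { (inj₁ _) → refl ; (inj₂ _) → refl })
  (λ { (zero , _) → refl ; (suc _ , _) → refl })

T↔Fin : ∀ b → T b ↔ Fin (if b then 1 else 0)
T↔Fin true  = ↔-sym 1↔⊤
T↔Fin false = ↔-sym 0↔⊥

Σ-Fin-T↔Fin : ∀ {m} (p : Fin m → Bool) → Σ ℕ λ n → Σ (Fin m) (T ∘ p) ↔ Fin n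
Σ-Fin-T↔Fin {zero} _ = 0 , mk↔ₛ′ (λ ()) (λ ()) (λ ()) (λ ())
Σ-Fin-T↔Fin {suc m} p =
  let n , Σ↔ = Σ-Fin-T↔Fin (p ∘ suc)
  in  (if p zero then 1 else 0) + n
    , ↔-trans Σ-Fin-suc↔⊎ (↔-trans (⊎-cong (T↔Fin (p zero)) Σ↔) (↔-sym +↔⊎))

Σ-T↔Fin : ∀ {A : Set} {m} → A ↔ Fin m → (p : A → Bool) → Σ ℕ λ n → Σ A (T ∘ p) ↔ Fin n
Σ-T↔Fin A↔ p =
  let n , Σ↔ = Σ-Fin-T↔Fin (p ∘ Inverse.from A↔)
  in  n , ↔-trans (↔-sym (Σ-↔ (↔-sym A↔) ↔-refl)) Σ↔

Σ-T-≡ : ∀ {A : Set} {p : A → Bool} {x y : Σ A (T ∘ p)} → proj₁ x ≡ proj₁ y → x ≡ y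
Σ-T-≡ {x = a , s} {.a , t} refl = cong (a ,_) (T-irrelevant s t)

↣⇒≤ : ∀ {A B : Set} {m n} → A ↔ Fin m → B ↔ Fin n → A ↣ B → m ≤ n
↣⇒≤ A↔ B↔ f = injective⇒≤ (Injection.injective (↣-trans (↔⇒↣ (↔-sym A↔)) (↣-trans f (↔⇒↣ B↔))))

⊆⇒∩≡ : ∀ {n} {X A : Subset n} → X ⊆ A → X ∩ A ≡ X
⊆⇒∩≡ {X = X} {A} X⊆A = ⊆-antisym (p∩q⊆p X A) (λ x∈X → x∈p∩q⁺ (x∈X , X⊆A x∈X))

∪-lub : ∀ {n} {X Y Z : Subset n} → X ⊆ Z → Y ⊆ Z → X ∪ Y ⊆ Z
∪-lub {X = X} {Y} X⊆Z Y⊆Z x∈X∪Y = [ X⊆Z , Y⊆Z ] (x∈p∪q⁻ X Y x∈X∪Y)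

x∷p⊆false∷q⇒x≡false : ∀ {n x} {X B : Subset n} → x ∷ X ⊆ false ∷ B → x ≡ false
x∷p⊆false∷q⇒x≡false {x = false} _ = refl
x∷p⊆false∷q⇒x≡false {x = true} x∷X⊆ = contradiction (x∷X⊆ here) λ ()

-- A subset S of Fin n is identified with Fin ∣ S ∣ (in increasing order);
-- extend and restrict transport subsets along this identification.
extend : ∀ {n} (S : Subset n) → Subset ∣ S ∣ → Subset n
extend []          _       = []
extend (true ∷ S)  (x ∷ u) = x ∷ extend S u
extend (false ∷ S) u       = false ∷ extend S u

restrict : ∀ {n} (S : Subset n) → Subset n → Subset ∣ S ∣
restrict []          _       = []
restrict (true ∷ S)  (x ∷ X) = x ∷ restrict S X
restrict (false ∷ S) (_ ∷ X) = restrict S X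

extend-⊆ : ∀ {n} (S : Subset n) u → extend S u ⊆ S
extend-⊆ []          _            = ⊆-refl
extend-⊆ (true ∷ S)  (true ∷ u)   = in⊆in (extend-⊆ S u)
extend-⊆ (true ∷ S)  (false ∷ u)  = out⊆ (extend-⊆ S u)
extend-⊆ (false ∷ S) u            = out⊆ (extend-⊆ S u)

restrict-∪-extend : ∀ {n} {X A : Subset n} B u → X ⊆ A → restrict (B ─ A) (X ∪ extend (B ─ A) u) ≡ u
restrict-∪-extend {X = []}    {[]}        []          [] _ = refl
restrict-∪-extend {X = _ ∷ _} {true ∷ _}  (_ ∷ B)     u X⊆A = restrict-∪-extend B u (drop-∷-⊆ X⊆A)
restrict-∪-extend {X = _ ∷ _} {false ∷ _} (false ∷ B) u X⊆A = restrict-∪-extend B u (drop-∷-⊆ X⊆A)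
restrict-∪-extend {X = _ ∷ _} {false ∷ _} (true ∷ B)  (y ∷ u) X⊆A =
  cong₂ _∷_ (cong (_∨ y) (x∷p⊆false∷q⇒x≡false X⊆A)) (restrict-∪-extend B u (drop-∷-⊆ X⊆A))

∪-extend-∩ : ∀ {n} {X A : Subset n} B u → X ⊆ A → (X ∪ extend (B ─ A) u) ∩ A ≡ X
∪-extend-∩ {X = []}    {[]}        []          _ _ = refl
∪-extend-∩ {X = x ∷ _} {true ∷ _}  (_ ∷ B)     u X⊆A =
  cong₂ _∷_ (trans (∧-identityʳ _) (∨-identityʳ x)) (∪-extend-∩ B u (drop-∷-⊆ X⊆A))
∪-extend-∩ {X = _ ∷ _} {false ∷ _} (false ∷ B) u X⊆A =
  cong₂ _∷_ (trans (∧-zeroʳ _) (sym (x∷p⊆false∷q⇒x≡false X⊆A))) (∪-extend-∩ B u (drop-∷-⊆ X⊆A))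
∪-extend-∩ {X = _ ∷ _} {false ∷ _} (true ∷ B)  (_ ∷ u) X⊆A =
  cong₂ _∷_ (trans (∧-zeroʳ _) (sym (x∷p⊆false∷q⇒x≡false X⊆A))) (∪-extend-∩ B u (drop-∷-⊆ X⊆A))

restrict-injective : ∀ {n} {X Y A B : Subset n} → X ⊆ B → Y ⊆ B → X ∩ A ≡ Y ∩ A →
                     restrict (B ─ A) X ≡ restrict (B ─ A) Y → X ≡ Y
restrict-injective {X = []} {[]} {[]} {[]} _ _ _ _ = refl
restrict-injective {X = _ ∷ _} {_ ∷ _} {true ∷ A} {false ∷ B} X⊆B Y⊆B ∩≡ r≡ =
  cong₂ _∷_ (trans (x∷p⊆false∷q⇒x≡false X⊆B) (sym (x∷p⊆false∷q⇒x≡false Y⊆B)))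
            (restrict-injective {A = A} {B} (drop-∷-⊆ X⊆B) (drop-∷-⊆ Y⊆B) (∷-injectiveʳ ∩≡) r≡)
restrict-injective {X = _ ∷ _} {_ ∷ _} {false ∷ A} {false ∷ B} X⊆B Y⊆B ∩≡ r≡ =
  cong₂ _∷_ (trans (x∷p⊆false∷q⇒x≡false X⊆B) (sym (x∷p⊆false∷q⇒x≡false Y⊆B)))
            (restrict-injective {A = A} {B} (drop-∷-⊆ X⊆B) (drop-∷-⊆ Y⊆B) (∷-injectiveʳ ∩≡) r≡)
restrict-injective {X = x ∷ _} {y ∷ _} {true ∷ A} {true ∷ B} X⊆B Y⊆B ∩≡ r≡ =
  cong₂ _∷_ (trans (sym (∧-identityʳ x)) (trans (∷-injectiveˡ ∩≡) (∧-identityʳ y)))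
            (restrict-injective {A = A} {B} (drop-∷-⊆ X⊆B) (drop-∷-⊆ Y⊆B) (∷-injectiveʳ ∩≡) r≡)
restrict-injective {X = _ ∷ _} {_ ∷ _} {false ∷ A} {true ∷ B} X⊆B Y⊆B ∩≡ r≡ =
  cong₂ _∷_ (∷-injectiveˡ r≡)
            (restrict-injective {A = A} {B} (drop-∷-⊆ X⊆B) (drop-∷-⊆ Y⊆B) (∷-injectiveʳ ∩≡) (∷-injectiveʳ r≡))

module _ {G : Graph} where

  SubG↔Fin : SubG G ↔ Fin (2 ^ (nV G + nE G))
  SubG↔Fin = ↔-trans (mk↔ₛ′ (λ X → Vs X , Es X) (λ (V , E) → sub V E) (λ _ → refl) (λ _ → refl))
                     (×↔Fin-2^+ (nV G) (nE G) Subset↔Fin Subset↔Fin)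

  ⊑-trans : {X Y Z : SubG G} → X ⊑ Y → Y ⊑ Z → X ⊑ Z
  ⊑-trans (V⊆ , E⊆) (V⊆′ , E⊆′) = ⊆-trans V⊆ V⊆′ , ⊆-trans E⊆ E⊆′

  ⊑⇒⊓≐ : {A X : SubG G} → A ⊑ X → (X ⊓ A) ≐ A
  ⊑⇒⊓≐ {A} {X} (V⊆ , E⊆) = trans (∩-comm (Vs X) (Vs A)) (⊆⇒∩≡ V⊆) , trans (∩-comm (Es X) (Es A)) (⊆⇒∩≡ E⊆)

  addNodes : SubG G → Subset (nV G) → SubG G
  addNodes X U = sub (Vs X ∪ U) (Es X)

  addNodes-isSubgraph : (X : SubG G) (U : Subset (nV G)) → IsSubgraph X → IsSubgraph (addNodes X U)
  addNodes-isSubgraph X U X-sub e e∈X = let s∈X , t∈X = X-sub e e∈X in p⊆p∪q U s∈X , p⊆p∪q U t∈X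

  ⊑-addNodes : (X : SubG G) (U : Subset (nV G)) → X ⊑ addNodes X U
  ⊑-addNodes X U = p⊆p∪q U , ⊆-refl

  addNodes-⊑ : {X Y : SubG G} {U : Subset (nV G)} → X ⊑ Y → U ⊆ Vs Y → addNodes X U ⊑ Y
  addNodes-⊑ (V⊆ , E⊆) U⊆ = ∪-lub V⊆ U⊆ , E⊆

  code : (A B : SubG G) → SubG G → Subset ∣ Vs B ─ Vs A ∣ × Subset ∣ Es B ─ Es A ∣
  code A B X = restrict (Vs B ─ Vs A) (Vs X) , restrict (Es B ─ Es A) (Es X)

  code-injective : {A B C X Y : SubG G} → X ⊑ B → Y ⊑ B → (X ⊓ A) ≐ C → (Y ⊓ A) ≐ C →
                   code A B X ≡ code A B Y → X ≡ Y
  code-injective (XV⊆ , XE⊆) (YV⊆ , YE⊆) (XV≡ , XE≡) (YV≡ , YE≡) code≡ =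
    cong₂ sub (restrict-injective XV⊆ YV⊆ (trans XV≡ (sym YV≡)) (cong proj₁ code≡))
              (restrict-injective XE⊆ YE⊆ (trans XE≡ (sym YE≡)) (cong proj₂ code≡))

module _ {TG : Graph} {H : Typed TG} (ρ : EffectOrientedRule H) where

  InducedRule↔Fin : Σ ℕ λ n → InducedRule ρ ↔ Fin n
  InducedRule↔Fin =
    let k = nV (G H) + nE (G H) in
    Σ-T↔Fin (×↔Fin-2^+ k k SubG↔Fin SubG↔Fin) (λ p → isYes (isInducedChoice? ρ (proj₁ p) (proj₂ p)))

  ΔVL ΔEL ΔVR ΔER : ℕ
  ΔVL = ∣ Vs (Lg ρ) ─ Vs (Lb ρ) ∣
  ΔEL = ∣ Es (Lg ρ) ─ Es (Lb ρ) ∣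
  ΔVR = ∣ Vs (Rg ρ) ─ Vs (Rb ρ) ∣
  ΔER = ∣ Es (Rg ρ) ─ Es (Rb ρ) ∣

  NodeCodes : Set
  NodeCodes = Subset ΔVL × Subset ΔVR

  Codes : Set
  Codes = (Subset ΔVL × Subset ΔEL) × (Subset ΔVR × Subset ΔER)

  codes : InducedRule ρ → Codes
  codes ((L , K) , _) = code (Lb ρ) (Lg ρ) L , code (Rb ρ) (Rg ρ) K

  choice-≡-from-codes : {L K L′ K′ : SubG (G H)} → IsInducedChoice ρ L K → IsInducedChoice ρ L′ K′ →
                        code (Lb ρ) (Lg ρ) L ≡ code (Lb ρ) (Lg ρ) L′ →
                        code (Rb ρ) (Rg ρ) K ≡ code (Rb ρ) (Rg ρ) K′ →
                        (L , K) ≡ (L′ , K′)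
  choice-≡-from-codes {L} {L′ = L′} ((_ , Lb⊑L , L⊑Lg) , (_ , _ , K⊑Rg , K⊓Rb≐Kg))
                                    ((_ , Lb⊑L′ , L′⊑Lg) , (_ , _ , K′⊑Rg , K′⊓Rb≐Kg)) L≡ K≡ =
    cong₂ _,_ (code-injective L⊑Lg L′⊑Lg (⊑⇒⊓≐ {X = L} Lb⊑L) (⊑⇒⊓≐ {X = L′} Lb⊑L′) L≡)
              (code-injective K⊑Rg K′⊑Rg K⊓Rb≐Kg K′⊓Rb≐Kg K≡)

  codes-injection : InducedRule ρ ↣ Codes
  codes-injection = mk↣ {to = codes} λ {(_ , s)} {(_ , t)} codes≡ →
    Σ-T-≡ (choice-≡-from-codes (toWitness s) (toWitness t) (cong proj₁ codes≡) (cong proj₂ codes≡))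

  Codes↔Fin : Codes ↔ Fin (2 ^ upperExp ρ)
  Codes↔Fin = ↔-trans (↔-sym (×-assoc _ _ _ _))
    (×↔Fin-2^+ (ΔVL + ΔEL + ΔVR) ΔER
      (×↔Fin-2^+ (ΔVL + ΔEL) ΔVR (×↔Fin-2^+ ΔVL ΔEL Subset↔Fin Subset↔Fin) Subset↔Fin) Subset↔Fin)

  nodeChoice : NodeCodes → SubG (G H) × SubG (G H)
  nodeChoice (u , v) = addNodes (Lb ρ) (extend (Vs (Lg ρ) ─ Vs (Lb ρ)) u)
                     , addNodes (Kg ρ) (extend (Vs (Rg ρ) ─ Vs (Rb ρ)) v)

  nodeChoice-induced : ∀ uv → IsInducedChoice ρ (proj₁ (nodeChoice uv)) (proj₂ (nodeChoice uv))
  nodeChoice-induced (u , v) =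
      ( addNodes-isSubgraph (Lb ρ) U (Lb-sub ρ)
      , ⊑-addNodes (Lb ρ) U
      , addNodes-⊑ {X = Lb ρ} {Lg ρ} (Lb⊑Lg ρ) (extend-─-⊆ (Vs (Lg ρ)) (Vs (Lb ρ)) u) )
    , ( addNodes-isSubgraph (Kg ρ) W (Kg-sub ρ)
      , ⊑-addNodes (Kg ρ) W
      , addNodes-⊑ {X = Kg ρ} {Rg ρ} (⊑-trans {X = Kg ρ} {Rb ρ} (Kg⊑Rb ρ) (Rb⊑Rg ρ))
                   (extend-─-⊆ (Vs (Rg ρ)) (Vs (Rb ρ)) v)
      , ∪-extend-∩ (Vs (Rg ρ)) v (proj₁ (Kg⊑Rb ρ)) , ⊆⇒∩≡ (proj₂ (Kg⊑Rb ρ)) )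
    where
    U = extend (Vs (Lg ρ) ─ Vs (Lb ρ)) u
    W = extend (Vs (Rg ρ) ─ Vs (Rb ρ)) v
    extend-─-⊆ : ∀ {n} (B A : Subset n) u → extend (B ─ A) u ⊆ B
    extend-─-⊆ B A u = ⊆-trans (extend-⊆ (B ─ A) u) (p─q⊆p B A)

  nodeRule : NodeCodes → InducedRule ρ
  nodeRule uv = nodeChoice uv , fromWitness (nodeChoice-induced uv)

  nodeCodes : InducedRule ρ → NodeCodes
  nodeCodes r = proj₁ (proj₁ (codes r)) , proj₁ (proj₂ (codes r))

  nodeCodes-nodeRule : ∀ uv → nodeCodes (nodeRule uv) ≡ uv
  nodeCodes-nodeRule (u , v) =
    cong₂ _,_ (restrict-∪-extend (Vs (Lg ρ)) u ⊆-refl) (restrict-∪-extend (Vs (Rg ρ)) v (proj₁ (Kg⊑Rb ρ)))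

  nodeRule-injection : NodeCodes ↣ InducedRule ρ
  nodeRule-injection = mk↣ {to = nodeRule} λ {uv} {uv′} rule≡ →
    trans (sym (nodeCodes-nodeRule uv)) (trans (cong nodeCodes rule≡) (nodeCodes-nodeRule uv′))

  NodeCodes↔Fin : NodeCodes ↔ Fin (2 ^ lowerExp ρ)
  NodeCodes↔Fin = ×↔Fin-2^+ ΔVL ΔVR Subset↔Fin Subset↔Fin

proposition2 : {TG : Graph} (H : Typed TG) (ρ : EffectOrientedRule H) →
    Σ ℕ (λ n → (InducedRule ρ ↔ Fin n) × (2 ^ lowerExp ρ ≤ n) × (n ≤ 2 ^ upperExp ρ))
proposition2 H ρ =
  let n , enum = InducedRule↔Fin ρ
  in  n , enum
        , ↣⇒≤ (NodeCodes↔Fin ρ) enum (nodeRule-injection ρ)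
        , ↣⇒≤ enum (Codes↔Fin ρ) (codes-injection ρ)
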